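{- Let $G$ be a connected graph and let $u,v_1,v_2,v_3$ be distinct vertices of $G$ with $\deg(v_1)=\deg(v_2)=\deg(v_3)=1$, such that $u$ is adjacent to $v_1$ and $v_2$ but not to $v_3$. Then $\mu(G)=\mu(G+uv_3)$.
   Context: All graphs are finite and simple. A path may consist of a single vertex. An $s$-path covering of $G$ is a set of $s$ vertex-disjoint paths in $G$ containing every vertex of $G$; $\mu(G)$ is the minimum $s\in\mathbb{N}$ such that $G$ has an $s$-path covering. $G+uv_3$ is $G$ with the edge $uv_3$ added. -}

module Defs where

open import Data.Bool using (Bool; true; false; T; _∨_; _∧_)
open import Data.Nat using (ℕ; _≤_)
open import Data.Fin using (Fin; _≟_)
open import Data.List using (List; []; _∷_; length; filterᵇ; allFin; concat)
open import Data.List.Relation.Unary.All using (All)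
open import Data.List.Relation.Unary.Linked using (Linked)
open import Data.List.Relation.Unary.Unique.Propositional using (Unique)
open import Data.List.Relation.Binary.Permutation.Propositional using (_↭_)
open import Data.Product using (Σ; _×_; _,_; proj₁; proj₂)
open import Relation.Binary.PropositionalEquality using (_≡_; _≢_; trans) renaming (sym to ≡-sym)
open import Data.Bool.Properties using (T-∨; T-∧)
open import Function.Bundles using (Equivalence)
open import Data.Sum using (inj₁; inj₂)
open import Relation.Nullary.Decidable using (toWitness)
open import Relation.Nullary using (¬_)
open import Data.Empty using (⊥; ⊥-elim)
open import Data.Unit using (⊤)
open import Relation.Nullary.Decidable using (⌊_⌋)

record Graph (n : ℕ) : Set where
  field
    adj   : Fin n → Fin n → Bool
    sym   : ∀ x y → T (adj x y) → T (adj y x)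
    irrefl : ∀ x → ¬ T (adj x x)
open Graph public

Adj : ∀ {n} → Graph n → Fin n → Fin n → Set
Adj G x y = T (adj G x y)

deg : ∀ {n} → Graph n → Fin n → ℕ
deg {n} G x = length (filterᵇ (adj G x) (allFin n))

data Reach {n} (G : Graph n) : Fin n → Fin n → Set where
  here : ∀ {x} → Reach G x x
  step : ∀ {x y z} → Adj G x y → Reach G y z → Reach G x z

Connected : ∀ {n} → Graph n → Set
Connected {n} G = (x y : Fin n) → Reach G x y

NonEmpty : ∀ {A : Set} → List A → Set
NonEmpty []      = ⊥
NonEmpty (_ ∷ _) = ⊤

IsPath : ∀ {n} → Graph n → List (Fin n) → Set
IsPath G p = NonEmpty p × Unique p × Linked (Adj G) p

-- an s-path covering: s paths, vertex-disjoint, covering every vertex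
-- (the concatenation of their vertex lists is a permutation of all vertices)
PathCovering : ∀ {n} → Graph n → ℕ → Set
PathCovering {n} G s =
  Σ (List (List (Fin n))) λ ps →
    (length ps ≡ s) × All (IsPath G) ps × (concat ps ↭ allFin n)

IsMu : ∀ {n} → Graph n → ℕ → Set
IsMu G m = PathCovering G m × (∀ s → PathCovering G s → m ≤ s)

private
  sym-aux : ∀ a a′ p q r s → (T a → T a′) →
            T (a ∨ (p ∧ q) ∨ (r ∧ s)) → T (a′ ∨ (s ∧ r) ∨ (q ∧ p))
  sym-aux true  true  _ _ _ _ f h = _
  sym-aux true  false _ _ _ _ f h = ⊥-elim (f h)
  sym-aux false true  _ _ _ _ f h = _
  sym-aux false false true  true  true  true  f h = _
  sym-aux false false true  true  true  false f h = _
  sym-aux false false true  true  false true  f h = _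
  sym-aux false false true  true  false false f h = _
  sym-aux false false true  false true  true  f h = _
  sym-aux false false true  false true  false f ()
  sym-aux false false true  false false true  f ()
  sym-aux false false true  false false false f ()
  sym-aux false false false true  true  true  f h = _
  sym-aux false false false true  true  false f ()
  sym-aux false false false true  false true  f ()
  sym-aux false false false true  false false f ()
  sym-aux false false false false true  true  f h = _
  sym-aux false false false false true  false f ()
  sym-aux false false false false false true  f ()
  sym-aux false false false false false false f ()

  irr-aux : ∀ a p q → ¬ T a → (T p → T q → ⊥) → ¬ T (a ∨ (p ∧ q) ∨ (q ∧ p))
  irr-aux true  _     _     na _ h = na h
  irr-aux false true  true  _  k h = k _ _
  irr-aux false true  false _  _ ()
  irr-aux false false true  _  _ ()
  irr-aux false false false _  _ ()

addEdge : ∀ {n} (G : Graph n) (u v : Fin n) → u ≢ v → Graph n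
addEdge G u v u≢v = record
  { adj = λ x y → adj G x y ∨ (⌊ x ≟ u ⌋ ∧ ⌊ y ≟ v ⌋) ∨ (⌊ x ≟ v ⌋ ∧ ⌊ y ≟ u ⌋)
  ; sym = λ x y → sym-aux (adj G x y) (adj G y x) ⌊ x ≟ u ⌋ ⌊ y ≟ v ⌋ ⌊ x ≟ v ⌋ ⌊ y ≟ u ⌋ (sym G x y)
  ; irrefl = λ x → irr-aux (adj G x x) ⌊ x ≟ u ⌋ ⌊ x ≟ v ⌋ (irrefl G x)
                     (λ p q → u≢v (trans (≡-sym (toWitness p)) (toWitness q)))
  }

module Submission where

-- Adding an edge cannot increase μ. Conversely, let an s-path covering of G + uv₃ use the edge uv₃ on
-- the path Q through u, so that Q splits into a piece ending at u and a piece starting at v₃. The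
-- pendants v₁, v₂ can only lie on Q next to u, and u has just one neighbour on Q besides v₃, so some
-- pendant w is off Q; its only neighbour being u, {w} is one of the paths. Attaching w to the u-piece
-- and keeping the v₃-piece separate gives an s-path covering of G.

open import Defs
open import Data.Nat using (ℕ; suc)
open import Data.Fin using (Fin; _≟_)
open import Data.Bool using (T; _∧_)
open import Data.Bool.Properties using (T-∨; T-∧)
open import Data.Product as Product using (_×_; _,_; proj₁; proj₂; ∃₂; ∃-syntax)
open import Data.Sum as Sum using (_⊎_; inj₁; inj₂)
open import Data.Empty using (⊥-elim)
open import Data.Unit using (tt)
open import Function using (_∘_)
open import Function.Bundles using (_⇔_; mk⇔; Equivalence)
open import Relation.Binary.Core using (Rel)
open import Relation.Binary.Definitions using (Symmetric)
open import Relation.Binary.PropositionalEquality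
  using (_≡_; _≢_; refl; cong; subst; setoid) renaming (sym to ≡-sym; trans to ≡-trans)
open import Relation.Nullary using (¬_; yes; no)
open import Relation.Nullary.Decidable using (toWitness; T?; ⌊_⌋)
open import Data.List using (List; []; _∷_; [_]; _++_; _ʳ++_; reverse; length; concat; allFin)
open import Data.List.Properties using (++-assoc; ++-ʳ++; ʳ++-defn; ∷-injectiveˡ)
open import Data.List.Relation.Unary.All as All using (All; []; _∷_)
open import Data.List.Relation.Unary.All.Properties as Allₚ using ()
open import Data.List.Relation.Unary.Any using (here; there)
open import Data.List.Relation.Unary.Linked as Linked using (Linked; []; [-]; _∷_)
open import Data.List.Relation.Unary.Unique.Propositional using (Unique)
open import Data.List.Relation.Unary.Unique.Propositional.Properties
  using (allFin⁺; Unique[x∷xs]⇒x∉xs)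
open import Data.List.Relation.Unary.AllPairs using ([]; _∷_)
open import Data.List.Membership.Propositional using (_∈_; _∉_)
open import Data.List.Membership.Propositional.Properties
  using (∈-++⁺ʳ; ∈-++⁻; ∈-∃++; ∈-concat⁺′; ∈-concat⁻′; ∈-filter⁺; ∈-allFin)
open import Data.List.Relation.Binary.Permutation.Propositional
  using ( _↭_; prep; ↭-sym; ↭-trans; ↭-reflexive; ↭-setoid; ↭-isEquivalence; ↭⇒↭ₛ; ↭⇒↭ₛ′
        ; module PermutationReasoning)
open import Data.List.Relation.Binary.Permutation.Propositional.Properties
  using (++-isCommutativeMonoid; shift; ++⁺ˡ; ++⁺ʳ; ↭-length; ↭-reverse; ∈-resp-↭; All-resp-↭)
import Data.List.Relation.Binary.Permutation.Setoid.Properties as SetoidPerm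

module _ {A : Set} where

  -- concat is a fold in the commutative monoid of lists up to permutation.
  concat-↭ : {xss yss : List (List A)} → xss ↭ yss → concat xss ↭ concat yss
  concat-↭ p = SetoidPerm.foldr-commMonoid ↭-setoid ++-isCommutativeMonoid (↭⇒↭ₛ′ ↭-isEquivalence p)

  ∈⇒↭∷ : ∀ {x : A} {xs} → x ∈ xs → ∃[ ys ] xs ↭ x ∷ ys
  ∈⇒↭∷ {x} x∈xs with ys , zs , refl ← ∈-∃++ x∈xs = ys ++ zs , shift x ys zs

  ∉-concat⁻ : ∀ {x : A} xss → x ∉ concat xss → All (x ∉_) xss
  ∉-concat⁻ xss x∉ = All.tabulate λ xs∈xss x∈xs → x∉ (∈-concat⁺′ x∈xs xs∈xss)

  length≡1⇒≡ : ∀ {xs : List A} {x y} → length xs ≡ 1 → x ∈ xs → y ∈ xs → x ≡ y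
  length≡1⇒≡ {_ ∷ []} refl (here refl) (here refl) = refl

  NonEmpty-++-∷ : ∀ (xs : List A) {x ys} → NonEmpty (xs ++ x ∷ ys)
  NonEmpty-++-∷ []      = tt
  NonEmpty-++-∷ (_ ∷ _) = tt

  reverse-++-∷-∷ : ∀ (xs : List A) {x y} ys →
                   reverse (xs ++ x ∷ y ∷ ys) ≡ reverse ys ++ y ∷ x ∷ reverse xs
  reverse-++-∷-∷ xs ys = ≡-trans (++-ʳ++ xs) (ʳ++-defn ys)

  Unique-++⁻ : ∀ (xs : List A) {ys} → Unique (xs ++ ys) → Unique xs × Unique ys
  Unique-++⁻ []       u        = [] , u
  Unique-++⁻ (x ∷ xs) (x≢ ∷ u) =
    Product.map₁ (Allₚ.++⁻ˡ xs x≢ ∷_) (Unique-++⁻ xs u)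

  Unique-++⇒∉ : ∀ (xs : List A) {ys x} → Unique (xs ++ ys) → x ∈ xs → x ∉ ys
  Unique-++⇒∉ (_ ∷ xs) (x≢ ∷ _) (here refl) x∈ys = All.lookup x≢ (∈-++⁺ʳ xs x∈ys) refl
  Unique-++⇒∉ (_ ∷ xs) (_ ∷ u)  (there x∈xs) = Unique-++⇒∉ xs u x∈xs

  Unique-concat⁻ : ∀ (xss : List (List A)) → Unique (concat xss) → All Unique xss
  Unique-concat⁻ []         _ = []
  Unique-concat⁻ (xs ∷ xss) u =
    let uxs , uxss = Unique-++⁻ xs u in uxs ∷ Unique-concat⁻ xss uxss

module _ {A : Set} {ℓ} {R : Rel A ℓ} where

  Linked-++⁻ : ∀ (xs : List A) {ys} → Linked R (xs ++ ys) → Linked R xs × Linked R ys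
  Linked-++⁻ []           l        = [] , l
  Linked-++⁻ (x ∷ [])     [-]      = [-] , []
  Linked-++⁻ (x ∷ [])     (_ ∷ l)  = [-] , l
  Linked-++⁻ (x ∷ y ∷ xs) (r ∷ l)  = Product.map₁ (r ∷_) (Linked-++⁻ (y ∷ xs) l)

  Linked-regraft : ∀ (xs : List A) {y ys zs} →
                   Linked R (xs ++ y ∷ ys) → Linked R (y ∷ zs) → Linked R (xs ++ y ∷ zs)
  Linked-regraft []           _       l = l
  Linked-regraft (x ∷ [])     (r ∷ _) l = r ∷ l
  Linked-regraft (x ∷ x′ ∷ xs) (r ∷ l′) l = r ∷ Linked-regraft (x′ ∷ xs) l′ l

  module _ (R-sym : Symmetric R) where

    Linked-ʳ++⁺ : ∀ {x} xs {ys} → Linked R (x ∷ xs) → Linked R (x ∷ ys) →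
                  Linked R (xs ʳ++ x ∷ ys)
    Linked-ʳ++⁺ []       _       l = l
    Linked-ʳ++⁺ (y ∷ xs) (r ∷ l′) l = Linked-ʳ++⁺ xs l′ (R-sym r ∷ l)

    Linked-reverse⁺ : ∀ {xs} → Linked R xs → Linked R (reverse xs)
    Linked-reverse⁺ {[]}     _ = []
    Linked-reverse⁺ {x ∷ xs} l = Linked-ʳ++⁺ xs l [-]

    Linked-isolated⇒≡[-] : ∀ {xs x} → Linked R xs → x ∈ xs →
                           (∀ {y} → R x y → y ∉ xs) → xs ≡ [ x ]
    Linked-isolated⇒≡[-] [-]     (here refl) _ = refl
    Linked-isolated⇒≡[-] (r ∷ _) (here refl) isolated = ⊥-elim (isolated r (there (here refl)))
    Linked-isolated⇒≡[-] (r ∷ l) (there x∈xs) isolated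
      with refl ← Linked-isolated⇒≡[-] l x∈xs (λ r′ y∈ → isolated r′ (there y∈)) =
      ⊥-elim (isolated (R-sym r) (here refl))

module _ {n : ℕ} where

  deg≡1⇒≡ : ∀ (G : Graph n) {x y z} → deg G x ≡ 1 → Adj G x y → Adj G x z → y ≡ z
  deg≡1⇒≡ G {x} {y} {z} d xy xz =
    length≡1⇒≡ d (∈-filter⁺ (T? ∘ adj G x) (∈-allFin y) xy)
                 (∈-filter⁺ (T? ∘ adj G x) (∈-allFin z) xz)

  IsWalk : Graph n → List (Fin n) → Set
  IsWalk G p = NonEmpty p × Linked (Adj G) p

  -- A path covering minus the Unique condition on each path, which the permutation condition implies.
  WalkCover : Graph n → List (List (Fin n)) → Set
  WalkCover G ps = All (IsWalk G) ps × concat ps ↭ allFin n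

  ↭allFin⇒Unique : ∀ {xs} → xs ↭ allFin n → Unique xs
  ↭allFin⇒Unique p = SetoidPerm.Unique-resp-↭ (setoid (Fin n)) (↭⇒↭ₛ (↭-sym p)) (allFin⁺ n)

  WalkCover-resp-↭ : ∀ (G : Graph n) {ps qs} → ps ↭ qs → WalkCover G ps → WalkCover G qs
  WalkCover-resp-↭ _ p (walks , perm) = All-resp-↭ p walks , ↭-trans (↭-sym (concat-↭ p)) perm

  walkCover⇒pathCovering : ∀ (G : Graph n) {ps} → WalkCover G ps → PathCovering G (length ps)
  walkCover⇒pathCovering _ {ps} (walks , perm) =
    ps , refl ,
    All.zipWith (λ ((ne , l) , u) → ne , u , l) (walks , Unique-concat⁻ ps (↭allFin⇒Unique perm)) ,
    perm

  PathCovering-mono : ∀ (G H : Graph n) {s} → (∀ {x y} → Adj G x y → Adj H x y) →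
                      PathCovering G s → PathCovering H s
  PathCovering-mono _ _ G⊆H (ps , len , paths , perm) =
    ps , len , All.map (Product.map₂ (Product.map₂ (Linked.map G⊆H))) paths , perm

  IsMu-cong : ∀ (G H : Graph n) {m} → (∀ {s} → PathCovering G s → PathCovering H s) →
              (∀ {s} → PathCovering H s → PathCovering G s) → IsMu G m ⇔ IsMu H m
  IsMu-cong _ _ G⇒H H⇒G = mk⇔ (λ (c , least) → G⇒H c , λ s c′ → least s (H⇒G c′))
                          (λ (c , least) → H⇒G c , λ s c′ → least s (G⇒H c′))

module AddEdge {n : ℕ} (G : Graph n) {a b : Fin n} (a≢b : a ≢ b) where

  G⁺ : Graph n
  G⁺ = addEdge G a b a≢b

  Adj-addEdge⁺ : ∀ {x y} → Adj G x y → Adj G⁺ x y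
  Adj-addEdge⁺ {x} {y} = Equivalence.from (T-∨ {adj G x y}) ∘ inj₁

  Adj-addEdge⁻ : ∀ {x y} → Adj G⁺ x y → Adj G x y ⊎ (x ≡ a × y ≡ b ⊎ x ≡ b × y ≡ a)
  Adj-addEdge⁻ {x} {y} e with Equivalence.to (T-∨ {adj G x y}) e
  ... | inj₁ g   = inj₁ g
  ... | inj₂ new =
    inj₂ (Sum.map (equalities a b) (equalities b a) (Equivalence.to (T-∨ {⌊ x ≟ a ⌋ ∧ ⌊ y ≟ b ⌋}) new))
    where
    equalities : ∀ c d → T (⌊ x ≟ c ⌋ ∧ ⌊ y ≟ d ⌋) → x ≡ c × y ≡ d
    equalities c d =
      Product.map (toWitness {a? = x ≟ c}) (toWitness {a? = y ≟ d}) ∘ Equivalence.to (T-∧ {⌊ x ≟ c ⌋})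

  Linked-addEdge⁻ : ∀ {xs} → Linked (Adj G⁺) xs → ¬ (a ∈ xs × b ∈ xs) → Linked (Adj G) xs
  Linked-addEdge⁻ []      _ = []
  Linked-addEdge⁻ [-]     _ = [-]
  Linked-addEdge⁻ (e ∷ l) notBoth with Adj-addEdge⁻ e
  ... | inj₁ g                    = g ∷ Linked-addEdge⁻ l (λ (a∈ , b∈) → notBoth (there a∈ , there b∈))
  ... | inj₂ (inj₁ (refl , refl)) = ⊥-elim (notBoth (here refl , there (here refl)))
  ... | inj₂ (inj₂ (refl , refl)) = ⊥-elim (notBoth (there (here refl) , here refl))

  Linked-addEdge-cut : ∀ {xs} → Linked (Adj G⁺) xs →
                       Linked (Adj G) xs ⊎ ∃₂ λ A B → xs ≡ A ++ a ∷ b ∷ B ⊎ xs ≡ A ++ b ∷ a ∷ B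
  Linked-addEdge-cut []      = inj₁ []
  Linked-addEdge-cut [-]     = inj₁ [-]
  Linked-addEdge-cut (_∷_ {x} e l) with Adj-addEdge⁻ e
  ... | inj₂ (inj₁ (refl , refl)) = inj₂ ([] , _ , inj₁ refl)
  ... | inj₂ (inj₂ (refl , refl)) = inj₂ ([] , _ , inj₂ refl)
  ... | inj₁ g with Linked-addEdge-cut l
  ...   | inj₁ l′             = inj₁ (g ∷ l′)
  ...   | inj₂ (A , B , cut) = inj₂ (x ∷ A , B , Sum.map (cong (x ∷_)) (cong (x ∷_)) cut)

  walks-avoiding-a : ∀ {ps} → All (IsWalk G⁺) ps → All (a ∉_) ps → All (IsWalk G) ps
  walks-avoiding-a walks a∉ps =
    All.zipWith (λ ((ne , l) , a∉) → ne , Linked-addEdge⁻ l (λ (a∈ , _) → a∉ a∈)) (walks , a∉ps)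

  reroute : ∀ A B {w rest} → Adj G a w →
            WalkCover G⁺ ((A ++ a ∷ b ∷ B) ∷ [ w ] ∷ rest) →
            WalkCover G ((A ++ a ∷ [ w ]) ∷ (b ∷ B) ∷ rest)
  reroute A B {w} {rest} aw ((_ , lQ) ∷ (_ ∷ walks) , perm) =
    (NonEmpty-++-∷ A , Linked-addEdge⁻ lAaw (λ (_ , b∈) → b∉Aaw b∈)) ∷
    (tt , Linked-addEdge⁻ lbB (λ (a∈ , _) → a∉bB a∈)) ∷
    walks-avoiding-a walks (∉-concat⁻ rest a∉rest) ,
    ↭-trans regroup perm
    where
    Q : List (Fin n)
    Q = A ++ a ∷ b ∷ B
    unique : Unique (Q ++ w ∷ concat rest)
    unique = ↭allFin⇒Unique perm
    uniqueQ : Unique Q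
    uniqueQ = proj₁ (Unique-++⁻ Q unique)
    a∉rest : a ∉ concat rest
    a∉rest a∈ = Unique-++⇒∉ Q unique (∈-++⁺ʳ A (here refl)) (there a∈)
    w∉Q : w ∉ Q
    w∉Q w∈ = Unique-++⇒∉ Q unique w∈ (here refl)
    a∉bB : a ∉ b ∷ B
    a∉bB = Unique[x∷xs]⇒x∉xs (proj₂ (Unique-++⁻ A uniqueQ))
    b∉Aaw : b ∉ A ++ a ∷ [ w ]
    b∉Aaw b∈ with ∈-++⁻ A b∈
    ... | inj₁ b∈A                 = Unique-++⇒∉ A uniqueQ b∈A (there (here refl))
    ... | inj₂ (here refl)         = a≢b refl
    ... | inj₂ (there (here refl)) = w∉Q (∈-++⁺ʳ A (there (here refl)))
    lAaw : Linked (Adj G⁺) (A ++ a ∷ [ w ])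
    lAaw = Linked-regraft A lQ (Adj-addEdge⁺ aw ∷ [-])
    lbB : Linked (Adj G⁺) (b ∷ B)
    lbB = Linked.tail (proj₂ (Linked-++⁻ A lQ))
    regroup : concat ((A ++ a ∷ [ w ]) ∷ (b ∷ B) ∷ rest) ↭ concat (Q ∷ [ w ] ∷ rest)
    regroup = begin
      (A ++ a ∷ [ w ]) ++ b ∷ B ++ C   ≡⟨ ++-assoc A _ _ ⟩
      A ++ a ∷ w ∷ b ∷ B ++ C          ↭⟨ ++⁺ˡ A (prep a (↭-sym (shift w (b ∷ B) C))) ⟩
      A ++ a ∷ b ∷ B ++ w ∷ C          ≡⟨ ++-assoc A _ _ ⟨
      Q ++ w ∷ C                       ∎
      where
      open PermutationReasoning
      C : List (Fin n)
      C = concat rest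

module TwoPendants {n : ℕ} (G : Graph n) {u v₁ v₂ v₃ : Fin n} (u≢v₃ : u ≢ v₃)
                   (v₁≢v₂ : v₁ ≢ v₂) (v₁≢v₃ : v₁ ≢ v₃) (v₂≢v₃ : v₂ ≢ v₃)
                   (deg-v₁ : deg G v₁ ≡ 1) (deg-v₂ : deg G v₂ ≡ 1)
                   (u-v₁ : Adj G u v₁) (u-v₂ : Adj G u v₂) where

  open AddEdge G u≢v₃
  open import Data.List.Membership.DecPropositional (_≟_ {n}) using (_∈?_)

  record Pendant (w : Fin n) : Set where
    field
      attached      : Adj G u w
      w≢v₃          : w ≢ v₃
      onlyNeighbour : ∀ {z} → Adj G⁺ w z → z ≡ u
  open Pendant

  pendant : ∀ {w} → deg G w ≡ 1 → Adj G u w → w ≢ v₃ → Pendant w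
  pendant {w} deg-w u-w w≢v₃ = record { attached = u-w ; w≢v₃ = w≢v₃ ; onlyNeighbour = only }
    where
    only : ∀ {z} → Adj G⁺ w z → z ≡ u
    only w-z with Adj-addEdge⁻ w-z
    ... | inj₁ g                  = deg≡1⇒≡ G deg-w g (sym G u w u-w)
    ... | inj₂ (inj₁ (refl , _))  = ⊥-elim (irrefl G u u-w)
    ... | inj₂ (inj₂ (w≡v₃ , _))  = ⊥-elim (w≢v₃ w≡v₃)

  pendant-in-walk : ∀ {w xs} → Pendant w → Linked (Adj G⁺) xs → w ∈ xs → u ∉ xs → xs ≡ [ w ]
  pendant-in-walk p l w∈ u∉ =
    Linked-isolated⇒≡[-] (λ {x} {y} → sym G⁺ x y) l w∈
      (λ w-z z∈ → u∉ (subst (_∈ _) (onlyNeighbour p w-z) z∈))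

  -- At most one of the two pendants v₁, v₂ can lie on a walk avoiding u, and only as the whole walk.
  pendant-outside : ∀ A → Linked (Adj G⁺) A → u ∉ A → ∃[ w ] Pendant w × w ∉ A
  pendant-outside A l u∉A with v₁ ∈? A
  ... | no v₁∉A = v₁ , pendant deg-v₁ u-v₁ v₁≢v₃ , v₁∉A
  ... | yes v₁∈A = v₂ , pendant deg-v₂ u-v₂ v₂≢v₃ , v₂∉A
    where
    v₂∉A : v₂ ∉ A
    v₂∉A v₂∈A with refl ← pendant-in-walk (pendant deg-v₁ u-v₁ v₁≢v₃) l v₁∈A u∉A
                 | here v₂≡v₁ ← v₂∈A = v₁≢v₂ (≡-sym v₂≡v₁)

  pendant-outside-cut : ∀ A B → Linked (Adj G⁺) (A ++ u ∷ v₃ ∷ B) → Unique (A ++ u ∷ v₃ ∷ B) →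
                        ∃[ w ] Pendant w × w ∉ A ++ u ∷ v₃ ∷ B
  pendant-outside-cut A B l unique =
    Product.map₂ (λ (p , w∉A) → p , outside p w∉A)
      (pendant-outside A (proj₁ (Linked-++⁻ A l)) (λ u∈A → Unique-++⇒∉ A unique u∈A (here refl)))
    where
    outside : ∀ {w} → Pendant w → w ∉ A → w ∉ A ++ u ∷ v₃ ∷ B
    outside p w∉A w∈ with ∈-++⁻ A w∈
    ... | inj₁ w∈A         = w∉A w∈A
    ... | inj₂ (here refl) = irrefl G u (attached p)
    ... | inj₂ (there w∈v₃B) =
      w≢v₃ p (≡-sym (∷-injectiveˡ (pendant-in-walk p (Linked.tail (proj₂ (Linked-++⁻ A l))) w∈v₃B
                                     (Unique[x∷xs]⇒x∉xs (proj₂ (Unique-++⁻ A unique))))))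

  pendant-singleton : ∀ {Q rest w} → WalkCover G⁺ (Q ∷ rest) → u ∈ Q → Pendant w → w ∉ Q →
                      ∃[ rest′ ] rest ↭ [ w ] ∷ rest′
  pendant-singleton {Q} {rest} {w} (_ ∷ walks , perm) u∈Q p w∉Q
    with ∈-++⁻ Q (∈-resp-↭ (↭-sym perm) (∈-allFin w))
  ... | inj₁ w∈Q = ⊥-elim (w∉Q w∈Q)
  ... | inj₂ w∈rest
    with R , w∈R , R∈rest ← ∈-concat⁻′ rest w∈rest
    with refl ← pendant-in-walk p (proj₂ (All.lookup walks R∈rest)) w∈R
                  (λ u∈R → Unique-++⇒∉ Q (↭allFin⇒Unique perm) u∈Q (∈-concat⁺′ u∈R R∈rest))
    = ∈⇒↭∷ R∈rest

  reroute-through-pendant : ∀ A B {rest} → WalkCover G⁺ ((A ++ u ∷ v₃ ∷ B) ∷ rest) →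
                            PathCovering G (suc (length rest))
  reroute-through-pendant A B cover@((_ , l) ∷ _ , perm)
    with w , p , w∉Q ← pendant-outside-cut A B l (proj₁ (Unique-++⁻ _ (↭allFin⇒Unique perm)))
    with rest′ , rest↭ ← pendant-singleton cover (∈-++⁺ʳ A (here refl)) p w∉Q
    = subst (PathCovering G) (cong suc (≡-sym (↭-length rest↭)))
        (walkCover⇒pathCovering G
          (reroute A B (attached p) (WalkCover-resp-↭ G⁺ (prep _ rest↭) cover)))

  WalkCover-addEdge⁻ : ∀ {Q rest} → WalkCover G⁺ (Q ∷ rest) → u ∈ Q →
                       PathCovering G (suc (length rest))
  WalkCover-addEdge⁻ {Q} {rest} cover@((ne , l) ∷ walks , perm) u∈Q with Linked-addEdge-cut l
  ... | inj₁ l′ =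
    walkCover⇒pathCovering G ((ne , l′) ∷ walks-avoiding-a walks (∉-concat⁻ rest u∉rest) , perm)
    where
    u∉rest : u ∉ concat rest
    u∉rest = Unique-++⇒∉ Q (↭allFin⇒Unique perm) u∈Q
  ... | inj₂ (A , B , inj₁ refl) = reroute-through-pendant A B cover
  ... | inj₂ (A , B , inj₂ refl) =
    reroute-through-pendant (reverse B) (reverse A)
      (reversed ∷ walks , ↭-trans (++⁺ʳ _ backwards) perm)
    where
    reversed : IsWalk G⁺ (reverse B ++ u ∷ v₃ ∷ reverse A)
    reversed = NonEmpty-++-∷ (reverse B) ,
               subst (Linked (Adj G⁺)) (reverse-++-∷-∷ A B)
                 (Linked-reverse⁺ (λ {x} {y} → sym G⁺ x y) l)
    backwards : reverse B ++ u ∷ v₃ ∷ reverse A ↭ A ++ v₃ ∷ u ∷ B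
    backwards = ↭-trans (↭-reflexive (≡-sym (reverse-++-∷-∷ A B))) (↭-reverse _)

  PathCovering-addEdge⁻ : ∀ {s} → PathCovering G⁺ s → PathCovering G s
  PathCovering-addEdge⁻ (ps , refl , paths , perm)
    with Q , u∈Q , Q∈ps ← ∈-concat⁻′ ps (∈-resp-↭ (↭-sym perm) (∈-allFin u))
    with rest , ps↭ ← ∈⇒↭∷ Q∈ps
    = subst (PathCovering G) (≡-sym (↭-length ps↭))
        (WalkCover-addEdge⁻ (WalkCover-resp-↭ G⁺ ps↭ cover) u∈Q)
    where
    cover : WalkCover G⁺ ps
    cover = All.map (λ (ne , _ , l) → ne , l) paths , perm

lemma4p2 : {n : ℕ} (G : Graph n) → Connected G →
    (u v₁ v₂ v₃ : Fin n) →
    u ≢ v₁ → u ≢ v₂ → (u≢v₃ : u ≢ v₃) → v₁ ≢ v₂ → v₁ ≢ v₃ → v₂ ≢ v₃ →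
    deg G v₁ ≡ 1 → deg G v₂ ≡ 1 → deg G v₃ ≡ 1 →
    Adj G u v₁ → Adj G u v₂ → ¬ Adj G u v₃ →
    (m : ℕ) → IsMu G m ⇔ IsMu (addEdge G u v₃ u≢v₃) m
lemma4p2 G _ u v₁ v₂ v₃ _ _ u≢v₃ v₁≢v₂ v₁≢v₃ v₂≢v₃ deg-v₁ deg-v₂ _ u-v₁ u-v₂ _ _ =
  IsMu-cong G G⁺ (PathCovering-mono G G⁺ Adj-addEdge⁺) PathCovering-addEdge⁻
  where
  open AddEdge G u≢v₃ using (G⁺; Adj-addEdge⁺)
  open TwoPendants G u≢v₃ v₁≢v₂ v₁≢v₃ v₂≢v₃ deg-v₁ deg-v₂ u-v₁ u-v₂ using (PathCovering-addEdge⁻)
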